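{- If $G_1,\dots,G_k$ is a finite family of strong integral sum graphs, then their direct product $\prod_{i=1}^k G_i$ is a strong integral sum graph.
   Context: A graph $G$ is an integral sum graph if there is a finite set $V\subseteq\mathbb{Z}$ such that $G$ is isomorphic to the graph with vertex set $V$ in which distinct $v,w$ are adjacent iff $v+w\in V$; it is a strong integral sum graph if moreover $V$ can be chosen with $2v\notin V$ for all $v\in V$. The direct (tensor) product $G\times H$ has vertex set $V(G)\times V(H)$, with $(g_1,h_1)$ adjacent to $(g_2,h_2)$ iff $g_1g_2\in E(G)$ and $h_1h_2\in E(H)$; the product of a finite family is defined iteratively (equivalently, adjacency in every coordinate). -}

module Defs where

open import Data.Nat using (ℕ; zero; suc)
open import Data.Fin using (Fin)
open import Data.Integer using (ℤ; _+_)
open import Data.List using (List; length; lookup)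
open import Data.List.Relation.Unary.Unique.Propositional using (Unique)
open import Data.Product using (Σ; ∃; _×_; _,_; proj₁; proj₂)
open import Relation.Binary.PropositionalEquality using (_≡_; _≢_)
open import Relation.Nullary using (¬_)
open import Function.Bundles using (_⤖_; _⇔_; Bijection)

record Graph : Set₁ where
  field
    Vtx    : Set
    Adj    : Vtx → Vtx → Set
    sym    : ∀ {x y} → Adj x y → Adj y x
    irrefl : ∀ {x} → ¬ Adj x x
open Graph public

_≅_ : Graph → Graph → Set
G ≅ H = Σ (Vtx G ⤖ Vtx H) λ f →
          ∀ x y → Adj G x y ⇔ Adj H (Bijection.to f x) (Bijection.to f y)

-- The sum graph of a finite set V ⊆ ℤ, given as a duplicate-free list:
-- vertices are the positions of the list (i.e. the elements of V),
-- distinct v, w adjacent iff v + w ∈ V.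
sumGraph : (V : List ℤ) → Unique V → Graph
sumGraph V u = record
  { Vtx    = Fin (length V)
  ; Adj    = λ i j → (i ≢ j) × ∃ λ k → lookup V k ≡ lookup V i + lookup V j
  ; sym    = λ { {i} {j} (i≢j , k , e) → (λ e' → i≢j (Relation.Binary.PropositionalEquality.sym e'))
                 , k , Relation.Binary.PropositionalEquality.trans e
                         (Data.Integer.Properties.+-comm (lookup V i) (lookup V j)) }
  ; irrefl = λ { (i≢i , _) → i≢i Relation.Binary.PropositionalEquality.refl }
  }
  where import Data.Integer.Properties

IsIntegralSumGraph : Graph → Set
IsIntegralSumGraph G = Σ (List ℤ) λ V → Σ (Unique V) λ u → G ≅ sumGraph V u

IsStrongIntegralSumGraph : Graph → Set
IsStrongIntegralSumGraph G =
  Σ (List ℤ) λ V → Σ (Unique V) λ u →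
    (G ≅ sumGraph V u) × (∀ i k → lookup V k ≢ lookup V i + lookup V i)

_⊗_ : Graph → Graph → Graph
G ⊗ H = record
  { Vtx    = Vtx G × Vtx H
  ; Adj    = λ p q → Adj G (proj₁ p) (proj₁ q) × Adj H (proj₂ p) (proj₂ q)
  ; sym    = λ { (a , b) → Graph.sym G a , Graph.sym H b }
  ; irrefl = λ { (a , _) → Graph.irrefl G a }
  }

∏ : (k : ℕ) → (Fin (suc k) → Graph) → Graph
∏ zero    G = G Fin.zero
∏ (suc k) G = G Fin.zero ⊗ ∏ k (λ i → G (Fin.suc i))

-- A strong integral sum graph is the same as a finite graph with an injective integer labelling
-- in which x and y are adjacent iff the sum of their labels is a label, and no label is twice a
-- label; the latter condition also makes "x ≠ y" automatic. For two such graphs label the pair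
-- (x, y) by f x · M + g y, where |g| ≤ B and M = 3B + 1: a label and a sum of two labels then
-- have "low digits" of absolute value at most B and 2B, so an equation between them splits into
-- one equation per coordinate. Hence adjacency and the doubling condition hold coordinatewise,
-- which is exactly adjacency in the direct product; induction on the number of factors finishes.
module Submission where

open import Defs hiding (sym)
open import Data.Nat as ℕ using (ℕ; zero; suc; _≤_; _<_; s≤s)
import Data.Nat.Properties as ℕ
open import Data.Integer using (ℤ; +_; _+_; _-_; _*_; ∣_∣)
import Data.Integer.Properties as ℤ
open import Data.Integer.Tactic.RingSolver using (solve-∀)
open import Data.Fin as Fin using (Fin; cast)
import Data.Fin.Properties as Fin
open import Data.List using (List; _∷_; length; lookup; tabulate)
import Data.List.Properties as List
import Data.List.Relation.Unary.All as All
open import Data.List.Membership.Propositional.Properties using (∈-lookup)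
open import Data.List.Relation.Unary.AllPairs using (_∷_)
open import Data.List.Relation.Unary.Unique.Propositional using (Unique)
import Data.List.Relation.Unary.Unique.Propositional.Properties as Unique
open import Data.Product using (Σ; ∃; _×_; _,_; proj₁; proj₂)
open import Data.Product.Function.NonDependent.Propositional using (_×-↔_)
open import Data.Empty using (⊥-elim)
open import Function using (_∘_)
open import Function.Bundles using (_↔_; _⤖_; _⇔_; Bijection; Inverse; Equivalence; mk⇔; mk↔ₛ′)
open import Function.Definitions using (Injective)
open import Function.Construct.Composition using (_↔-∘_)
open import Function.Properties.Inverse using (↔-sym; ↔⇒⤖)
open import Function.Properties.Bijection using (⤖⇒↔)
open import Relation.Binary.PropositionalEquality

Finite : Set → Set
Finite X = Σ ℕ λ n → X ↔ Fin n

DoublingFree : List ℤ → Set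
DoublingFree V = ∀ i k → lookup V k ≢ lookup V i + lookup V i

record StrongSumLabelling (G : Graph) : Set where
  field
    label        : Vtx G → ℤ
    injective    : Injective _≡_ _≡_ label
    adj⇔sum      : ∀ x y → Adj G x y ⇔ ∃ λ z → label z ≡ label x + label y
    sum≢double   : ∀ x z → label z ≢ label x + label x

  sum⇒distinct : ∀ {x y z} → label z ≡ label x + label y → x ≢ y
  sum⇒distinct {x} {z = z} e refl = sum≢double x z e

open StrongSumLabelling

lookup-injective : (V : List ℤ) → Unique V → Injective _≡_ _≡_ (lookup V)
lookup-injective (v ∷ V) _          {Fin.zero}  {Fin.zero}  e = refl
lookup-injective (v ∷ V) (v∉V ∷ _)  {Fin.zero}  {Fin.suc j} e = ⊥-elim (All.lookup v∉V (∈-lookup j) e)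
lookup-injective (v ∷ V) (v∉V ∷ _)  {Fin.suc i} {Fin.zero}  e = ⊥-elim (All.lookup v∉V (∈-lookup i) (sym e))
lookup-injective (v ∷ V) (_ ∷ uV)   {Fin.suc i} {Fin.suc j} e = cong Fin.suc (lookup-injective V uV e)

sumGraph-labelling : (V : List ℤ) (u : Unique V) → DoublingFree V →
                     StrongSumLabelling (sumGraph V u)
sumGraph-labelling V u free = record
  { label      = lookup V
  ; injective  = lookup-injective V u
  ; adj⇔sum    = λ i j → mk⇔ proj₂ λ { s@(k , e) → (λ { refl → free i k e }) , s }
  ; sum≢double = free
  }

≅-labelling : ∀ {G H} → G ≅ H → StrongSumLabelling H → StrongSumLabelling G
≅-labelling {G} (φ , φ-adj) L = record
  { label      = label L ∘ to
  ; injective  = Bijection.injective φ ∘ injective L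
  ; adj⇔sum    = λ x y → mk⇔ (fwd x y) (bwd x y)
  ; sum≢double = λ x z → sum≢double L (to x) (to z)
  }
  where
  open Bijection φ using (to; strictlySurjective)
  fwd : ∀ x y → Adj G x y → ∃ λ z → label L (to z) ≡ label L (to x) + label L (to y)
  fwd x y a with Equivalence.to (adj⇔sum L (to x) (to y)) (Equivalence.to (φ-adj x y) a)
  ... | w , e with strictlySurjective w
  ...   | z , refl = z , e
  bwd : ∀ x y → (∃ λ z → label L (to z) ≡ label L (to x) + label L (to y)) → Adj G x y
  bwd x y (z , e) = Equivalence.from (φ-adj x y) (Equivalence.from (adj⇔sum L (to x) (to y)) (to z , e))

labelling-≅-sumGraph : ∀ {G} (L : StrongSumLabelling G) (V : List ℤ) (u : Unique V)
  (b : Vtx G ⤖ Fin (length V)) → (∀ x → lookup V (Bijection.to b x) ≡ label L x) →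
  (G ≅ sumGraph V u) × DoublingFree V
labelling-≅-sumGraph {G} L V u b b-label = (b , λ x y → mk⇔ (fwd x y) (bwd x y)) , free
  where
  open Bijection b using (to; strictlySurjective)
  preimage-label : ∀ k → label L (proj₁ (strictlySurjective k)) ≡ lookup V k
  preimage-label k = trans (sym (b-label _)) (cong (lookup V) (proj₂ (strictlySurjective k)))
  fwd : ∀ x y → Adj G x y → Adj (sumGraph V u) (to x) (to y)
  fwd x y a with Equivalence.to (adj⇔sum L x y) a
  ... | z , e = (λ bx≡by → sum⇒distinct L e (Bijection.injective b bx≡by))
              , to z , trans (b-label z) (trans e (sym (cong₂ _+_ (b-label x) (b-label y))))
  bwd : ∀ x y → Adj (sumGraph V u) (to x) (to y) → Adj G x y
  bwd x y (_ , k , e) = Equivalence.from (adj⇔sum L x y)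
    (_ , trans (preimage-label k) (trans e (cong₂ _+_ (b-label x) (b-label y))))
  free : DoublingFree V
  free i k e = sum≢double L _ _
    (trans (preimage-label k) (trans e (sym (cong₂ _+_ (preimage-label i) (preimage-label i)))))

strong⇒labelled : ∀ {G} → IsStrongIntegralSumGraph G → Finite (Vtx G) × StrongSumLabelling G
strong⇒labelled (V , u , G≅V@(φ , _) , free) =
  (length V , ⤖⇒↔ φ) , ≅-labelling G≅V (sumGraph-labelling V u free)

cast-↔ : ∀ {m n} → m ≡ n → Fin m ↔ Fin n
cast-↔ eq = mk↔ₛ′ (cast eq) (cast (sym eq)) (Fin.cast-involutive eq (sym eq)) (Fin.cast-involutive (sym eq) eq)

labelled⇒strong : ∀ {G} → Finite (Vtx G) → StrongSumLabelling G → IsStrongIntegralSumGraph G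
labelled⇒strong {G} (n , e) L = V , u , labelling-≅-sumGraph L V u b b-label
  where
  open Inverse e using (to; from; strictlyInverseʳ)
  labels : Fin n → ℤ
  labels = label L ∘ from
  V : List ℤ
  V = tabulate labels
  u : Unique V
  u = Unique.tabulate⁺ (Bijection.injective (↔⇒⤖ (↔-sym e)) ∘ injective L)
  b : Vtx G ⤖ Fin (length V)
  b = ↔⇒⤖ (cast-↔ (sym (List.length-tabulate labels)) ↔-∘ e)
  b-label : ∀ x → lookup V (Bijection.to b x) ≡ label L x
  b-label x = trans (List.lookup-tabulate labels (to x)) (cong (label L) (strictlyInverseʳ x))

×-finite : ∀ {X Y} → Finite X → Finite Y → Finite (X × Y)
×-finite (m , e) (n , e′) = m ℕ.* n , ↔-sym Fin.*↔× ↔-∘ (e ×-↔ e′)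

Fin-bounded : ∀ {n} (g : Fin n → ℤ) → ∃ λ B → ∀ i → ∣ g i ∣ ≤ B
Fin-bounded {zero}  g = 0 , λ ()
Fin-bounded {suc n} g with Fin-bounded (g ∘ Fin.suc)
... | B , bound = ∣ g Fin.zero ∣ ℕ.+ B , λ
  { Fin.zero    → ℕ.m≤m+n _ B
  ; (Fin.suc i) → ℕ.≤-trans (bound i) (ℕ.m≤n+m B _)
  }

finite-bounded : ∀ {X} → Finite X → (f : X → ℤ) → ∃ λ B → ∀ x → ∣ f x ∣ ≤ B
finite-bounded (n , e) f with Fin-bounded (f ∘ Inverse.from e)
... | B , bound = B , λ x → subst (λ y → ∣ f y ∣ ≤ B) (Inverse.strictlyInverseʳ e x) (bound (Inverse.to e x))

digits-unique : ∀ m {a b c d} → ∣ b ∣ ℕ.+ ∣ d ∣ < m →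
                a * + m + b ≡ c * + m + d → a ≡ c × b ≡ d
digits-unique m {a} {b} {c} {d} small eq = a≡c , sym (ℤ.i-j≡0⇒i≡j d b d-b≡0)
  where
  shift : (a - c) * + m ≡ d - b
  shift = begin
    (a - c) * + m                 ≡⟨ add-low a b c (+ m) ⟩
    (a * + m + b) - (c * + m + b) ≡⟨ cong (_- (c * + m + b)) eq ⟩
    (c * + m + d) - (c * + m + b) ≡⟨ cancel-high c d b (+ m) ⟩
    d - b                         ∎
    where
    open ≡-Reasoning
    add-low : ∀ a b c M → (a - c) * M ≡ (a * M + b) - (c * M + b)
    add-low = solve-∀
    cancel-high : ∀ c d b M → (c * M + d) - (c * M + b) ≡ d - b
    cancel-high = solve-∀
  ∣a-c∣≡0 : ∣ a - c ∣ ≡ 0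
  ∣a-c∣≡0 with ∣ a - c ∣ in ∣a-c∣≡
  ... | zero  = refl
  ... | suc t = ⊥-elim (ℕ.<⇒≱ small (begin
    m                       ≤⟨ ℕ.m≤m+n m (t ℕ.* m) ⟩
    suc t ℕ.* m             ≡⟨ cong (ℕ._* m) ∣a-c∣≡ ⟨
    ∣ a - c ∣ ℕ.* m         ≡⟨ ℤ.abs-* (a - c) (+ m) ⟨
    ∣ (a - c) * + m ∣       ≡⟨ cong ∣_∣ shift ⟩
    ∣ d - b ∣               ≤⟨ ℤ.∣i-j∣≤∣i∣+∣j∣ d b ⟩
    ∣ d ∣ ℕ.+ ∣ b ∣         ≡⟨ ℕ.+-comm ∣ d ∣ ∣ b ∣ ⟩
    ∣ b ∣ ℕ.+ ∣ d ∣         ∎))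
    where open ℕ.≤-Reasoning
  a≡c : a ≡ c
  a≡c = ℤ.i-j≡0⇒i≡j a c (ℤ.∣i∣≡0⇒i≡0 ∣a-c∣≡0)
  d-b≡0 : d - b ≡ + 0
  d-b≡0 = begin
    d - b         ≡⟨ shift ⟨
    (a - c) * + m ≡⟨ cong (λ x → (x - c) * + m) a≡c ⟩
    (c - c) * + m ≡⟨ cong (_* + m) (ℤ.+-inverseʳ c) ⟩
    + 0 * + m     ≡⟨ ℤ.*-zeroˡ (+ m) ⟩
    + 0           ∎
    where open ≡-Reasoning

digitwise-+ : ∀ m a₁ b₁ a₂ b₂ → (a₁ + a₂) * m + (b₁ + b₂) ≡ (a₁ * m + b₁) + (a₂ * m + b₂)
digitwise-+ = solve-∀

module _ {G H : Graph} (LG : StrongSumLabelling G) (LH : StrongSumLabelling H)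
         (B : ℕ) (bounded : ∀ y → ∣ label LH y ∣ ≤ B) where

  private
    f = label LG
    g = label LH

  radix : ℕ
  radix = suc (B ℕ.+ (B ℕ.+ B))

  label⊗ : Vtx G × Vtx H → ℤ
  label⊗ (x , y) = f x * + radix + g y

  low-digits-small : ∀ y s → ∣ s ∣ ≤ B ℕ.+ B → ∣ g y ∣ ℕ.+ ∣ s ∣ < radix
  low-digits-small y s s≤2B = s≤s (ℕ.+-mono-≤ (bounded y) s≤2B)

  label⊗-sum : ∀ x y x₁ y₁ x₂ y₂ →
    label⊗ (x , y) ≡ label⊗ (x₁ , y₁) + label⊗ (x₂ , y₂) ⇔
    (f x ≡ f x₁ + f x₂ × g y ≡ g y₁ + g y₂)
  label⊗-sum x y x₁ y₁ x₂ y₂ = mk⇔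
    (λ e → digits-unique radix (low-digits-small y (g y₁ + g y₂) sum≤2B)
             (trans e (sym (digitwise-+ (+ radix) (f x₁) (g y₁) (f x₂) (g y₂)))))
    (λ { (e₁ , e₂) → trans (cong₂ (λ a b → a * + radix + b) e₁ e₂)
                           (digitwise-+ (+ radix) (f x₁) (g y₁) (f x₂) (g y₂)) })
    where
    sum≤2B : ∣ g y₁ + g y₂ ∣ ≤ B ℕ.+ B
    sum≤2B = ℕ.≤-trans (ℤ.∣i+j∣≤∣i∣+∣j∣ (g y₁) (g y₂)) (ℕ.+-mono-≤ (bounded y₁) (bounded y₂))

  ⊗-labelling : StrongSumLabelling (G ⊗ H)
  ⊗-labelling = record
    { label      = label⊗
    ; injective  = inj
    ; adj⇔sum    = λ { (x₁ , y₁) (x₂ , y₂) → mk⇔ (fwd x₁ y₁ x₂ y₂) (bwd x₁ y₁ x₂ y₂) }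
    ; sum≢double = λ { (x₁ , y₁) (x , y) e →
                       sum≢double LG x₁ x (proj₁ (Equivalence.to (label⊗-sum x y x₁ y₁ x₁ y₁) e)) }
    }
    where
    inj : Injective _≡_ _≡_ label⊗
    inj {x , y} {x′ , y′} e with digits-unique radix
                                   (low-digits-small y (g y′) (ℕ.≤-trans (bounded y′) (ℕ.m≤n+m B B))) e
    ... | e₁ , e₂ = cong₂ _,_ (injective LG e₁) (injective LH e₂)
    fwd : ∀ x₁ y₁ x₂ y₂ → Adj G x₁ x₂ × Adj H y₁ y₂ →
          ∃ λ p → label⊗ p ≡ label⊗ (x₁ , y₁) + label⊗ (x₂ , y₂)
    fwd x₁ y₁ x₂ y₂ (a , c) with Equivalence.to (adj⇔sum LG x₁ x₂) a | Equivalence.to (adj⇔sum LH y₁ y₂) c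
    ... | x , e₁ | y , e₂ = (x , y) , Equivalence.from (label⊗-sum x y x₁ y₁ x₂ y₂) (e₁ , e₂)
    bwd : ∀ x₁ y₁ x₂ y₂ → (∃ λ p → label⊗ p ≡ label⊗ (x₁ , y₁) + label⊗ (x₂ , y₂)) →
          Adj G x₁ x₂ × Adj H y₁ y₂
    bwd x₁ y₁ x₂ y₂ ((x , y) , e) with Equivalence.to (label⊗-sum x y x₁ y₁ x₂ y₂) e
    ... | e₁ , e₂ = Equivalence.from (adj⇔sum LG x₁ x₂) (x , e₁)
                  , Equivalence.from (adj⇔sum LH y₁ y₂) (y , e₂)

strong-⊗ : ∀ G H → IsStrongIntegralSumGraph G → IsStrongIntegralSumGraph H →
           IsStrongIntegralSumGraph (G ⊗ H)
strong-⊗ G H sG sH with strong⇒labelled {G} sG | strong⇒labelled {H} sH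
... | finG , LG | finH , LH with finite-bounded finH (label LH)
...   | B , bounded = labelled⇒strong (×-finite finG finH) (⊗-labelling LG LH B bounded)

mainTheorem13 : (k : ℕ) (G : Fin (suc k) → Graph) →
    (∀ i → IsStrongIntegralSumGraph (G i)) →
    IsStrongIntegralSumGraph (∏ k G)
mainTheorem13 zero    G strong = strong Fin.zero
mainTheorem13 (suc k) G strong =
  strong-⊗ (G Fin.zero) (∏ k (G ∘ Fin.suc))
           (strong Fin.zero) (mainTheorem13 k (G ∘ Fin.suc) (strong ∘ Fin.suc))
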